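{- Let $n\ge 2$ and $1\le k\le n-1$. The number ${c^\ast}^k_n$ of circular permutations of $[n]$ that avoid all substrings $j(j+k)$, $1\le j\le n-k$, is $${c^\ast}^k_n=\sum_{j=0}^{n-k}(-1)^j\binom{n-k}{j}(n-j-1)!.$$
   Context: A circular permutation of $[n]=\{1,\dots,n\}$ is an arrangement of $1,\dots,n$ around a circle considered up to rotation (equivalently, a cyclic order, written in cycle notation such as $(1234)$; there are $(n-1)!$ of them). A circular permutation avoids the substring $ab$ if $b$ is not the element immediately following $a$ in the cyclic order (including the wrap-around from the last written element to the first). -}

module Defs where

open import Data.Nat using (ℕ; zero; suc; _∸_; _+_; _!)
open import Data.Nat.Combinatorics using (_C_)
open import Data.Integer as ℤ using (ℤ; +_; -[1+_])
open import Data.List using (List; []; _∷_; _++_; [_]; applyUpTo; upTo; map; foldr; length)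
open import Data.List.Relation.Binary.Permutation.Propositional using (_↭_)
open import Data.List.Relation.Unary.Unique.Propositional using (Unique)
open import Data.List.Membership.Propositional using (_∈_)
open import Data.Product using (Σ; ∃; _×_; _,_)
open import Function.Bundles using (_⇔_)
open import Relation.Binary.PropositionalEquality using (_≡_)
open import Relation.Nullary using (¬_)

[_]ₙ : ℕ → List ℕ
[ n ]ₙ = applyUpTo suc n

-- A circular permutation of [n] is a cyclic order of 1..n up to rotation.
-- We represent each rotation class by its unique representative written
-- starting from 1: a list 1 ∷ rest which is a rearrangement of 1..n.
CircPerm : ℕ → List ℕ → Set
CircPerm n w = Σ (List ℕ) λ rest → (w ≡ 1 ∷ rest) × (w ↭ [ n ]ₙ)

Adjacent : List ℕ → ℕ → ℕ → Set
Adjacent l a b = ∃ λ xs → ∃ λ ys → l ≡ xs ++ (a ∷ b ∷ ys)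

-- b immediately follows a in the cyclic order written by w
-- (including the wrap-around from the last written element to the first)
CycFollows : List ℕ → ℕ → ℕ → Set
CycFollows [] a b = Adjacent [] a b
CycFollows (x ∷ xs) a b = Adjacent ((x ∷ xs) ++ [ x ]) a b

AvoidsAll : ℕ → ℕ → List ℕ → Set
AvoidsAll n k w = ∀ j → 1 Data.Nat.≤ j → j Data.Nat.≤ n ∸ k → ¬ CycFollows w j (j + k)

HasCount : (List ℕ → Set) → ℕ → Set
HasCount P N = ∃ λ (cs : List (List ℕ)) →
  Unique cs × (∀ w → (w ∈ cs) ⇔ P w) × (length cs ≡ N)

formula : ℕ → ℕ → ℤ
formula n k = foldr ℤ._+_ (+ 0) (map term (upTo (suc (n ∸ k))))
  where
  term : ℕ → ℤ
  term j = (-[1+ 0 ] ℤ.^ j) ℤ.* (+ ((n ∸ k) C j)) ℤ.* (+ ((n ∸ j ∸ 1) !))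

-- Write a circular permutation of [n] starting from 1, i.e. as 1 followed by a permutation of
-- 2, …, n, and treat the forbidden substrings j (j + k) as a list of pairs (a , b) with a < b,
-- pairwise distinct first and pairwise distinct second components. The words avoiding the pairs P
-- split into those avoiding a further pair (a , b) and those containing ab, and deleting b maps the
-- latter bijectively onto the words on one letter fewer avoiding P with b renamed to a. So the
-- number c m N of words on N letters avoiding m pairs satisfies c m N = c (m - 1) N - c (m - 1) (N - 1)
-- and c 0 N = (N - 1)!: it is the m-th backward difference of (N - 1)!, which is the alternating
-- binomial sum of the statement.

module Submission where

open import Defs

module AlternatingSum where

  open import Data.Nat using (ℕ; zero; suc; _∸_; _!)
  open import Data.Nat.Combinatorics using (_C_; nCk+nC[k+1]≡[n+1]C[k+1])
  open import Data.Nat.Combinatorics.Specification using (k>n⇒nCk≡0)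
  import Data.Nat.Properties as ℕ
  open import Data.Integer as ℤ using (ℤ; +_; -[1+_]; _+_; _*_; -_; _-_)
  import Data.Integer.Properties as ℤ
  open import Data.Integer.Tactic.RingSolver using (solve-∀)
  open import Data.List using (applyUpTo; map; foldr)
  open import Function using (_∘_)
  open import Relation.Binary.PropositionalEquality

  ∑ : ℕ → (ℕ → ℤ) → ℤ
  ∑ zero    g = + 0
  ∑ (suc l) g = g 0 + ∑ l (g ∘ suc)

  foldr-map-applyUpTo≡∑ : ∀ (g : ℕ → ℤ) f l → foldr _+_ (+ 0) (map g (applyUpTo f l)) ≡ ∑ l (g ∘ f)
  foldr-map-applyUpTo≡∑ g f zero    = refl
  foldr-map-applyUpTo≡∑ g f (suc l) = cong (_+_ (g (f 0))) (foldr-map-applyUpTo≡∑ g (f ∘ suc) l)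

  ∑-cong : ∀ {g h : ℕ → ℤ} l → (∀ j → g j ≡ h j) → ∑ l g ≡ ∑ l h
  ∑-cong zero    g≗h = refl
  ∑-cong (suc l) g≗h = cong₂ _+_ (g≗h 0) (∑-cong l (g≗h ∘ suc))

  ∑-distrib-+ : ∀ l (g h : ℕ → ℤ) → ∑ l (λ j → g j + h j) ≡ ∑ l g + ∑ l h
  ∑-distrib-+ zero    g h = refl
  ∑-distrib-+ (suc l) g h =
    trans (cong (_+_ (g 0 + h 0)) (∑-distrib-+ l (g ∘ suc) (h ∘ suc))) (+-interchange (g 0) (h 0) _ _)
    where
    +-interchange : ∀ a b c d → (a + b) + (c + d) ≡ (a + c) + (b + d)
    +-interchange = solve-∀

  ∑-neg : ∀ l (g : ℕ → ℤ) → ∑ l (λ j → - g j) ≡ - ∑ l g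
  ∑-neg zero    g = refl
  ∑-neg (suc l) g = trans (cong (_+_ (- g 0)) (∑-neg l (g ∘ suc))) (sym (ℤ.neg-distrib-+ (g 0) _))

  ∑-suc : ∀ l (g : ℕ → ℤ) → ∑ (suc l) g ≡ ∑ l g + g l
  ∑-suc zero    g = ℤ.+-comm (g 0) (+ 0)
  ∑-suc (suc l) g = trans (cong (_+_ (g 0)) (∑-suc l (g ∘ suc))) (sym (ℤ.+-assoc (g 0) _ _))

  ∇fact : ℕ → ℕ → ℤ
  ∇fact zero    N = + ((N ∸ 1) !)
  ∇fact (suc m) N = ∇fact m N - ∇fact m (N ∸ 1)

  alternatingTerm : ℕ → ℕ → ℕ → ℤ
  alternatingTerm m N j = (-[1+ 0 ] ℤ.^ j) * + (m C j) * + ((N ∸ j ∸ 1) !)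

  alternatingTerm-pascal : ∀ m N j →
    alternatingTerm (suc m) N (suc j) ≡ - alternatingTerm m (N ∸ 1) j + alternatingTerm m N (suc j)
  alternatingTerm-pascal m N j
    rewrite sym (nCk+nC[k+1]≡[n+1]C[k+1] m j) | ℤ.pos-+ (m C j) (m C suc j) | ℕ.∸-+-assoc N 1 j
    = distrib (-[1+ 0 ] ℤ.^ j) (+ (m C j)) (+ (m C suc j)) (+ ((N ∸ suc j ∸ 1) !))
    where
    distrib : ∀ s c c′ f → (-[1+ 0 ] * s) * (c + c′) * f ≡ - (s * c * f) + (-[1+ 0 ] * s) * c′ * f
    distrib = solve-∀

  alternatingTerm-vanishes : ∀ m N → alternatingTerm m N (suc m) ≡ + 0
  alternatingTerm-vanishes m N rewrite k>n⇒nCk≡0 (ℕ.n<1+n m) =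
    trans (cong (_* + ((N ∸ suc m ∸ 1) !)) (ℤ.*-zeroʳ (-[1+ 0 ] ℤ.^ suc m))) (ℤ.*-zeroˡ (+ ((N ∸ suc m ∸ 1) !)))

  ∑alternatingTerm≡∇fact : ∀ m N → ∑ (suc m) (alternatingTerm m N) ≡ ∇fact m N
  ∑alternatingTerm≡∇fact zero    N = trans (ℤ.+-identityʳ _) (ℤ.*-identityˡ _)
  ∑alternatingTerm≡∇fact (suc m) N = begin
    t m N 0 + ∑ (suc m) (t (suc m) N ∘ suc)
      ≡⟨ cong (_+_ (t m N 0)) (∑-cong (suc m) (alternatingTerm-pascal m N)) ⟩
    t m N 0 + ∑ (suc m) (λ j → - t m (N ∸ 1) j + t m N (suc j))
      ≡⟨ cong (_+_ (t m N 0)) (∑-distrib-+ (suc m) (λ j → - t m (N ∸ 1) j) (t m N ∘ suc)) ⟩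
    t m N 0 + (∑ (suc m) (λ j → - t m (N ∸ 1) j) + ∑ (suc m) (t m N ∘ suc))
      ≡⟨ cong (λ z → t m N 0 + (z + ∑ (suc m) (t m N ∘ suc))) (∑-neg (suc m) (t m (N ∸ 1))) ⟩
    t m N 0 + (- ∑ (suc m) (t m (N ∸ 1)) + ∑ (suc m) (t m N ∘ suc))
      ≡⟨ rearrange (t m N 0) (∑ (suc m) (t m (N ∸ 1))) (∑ (suc m) (t m N ∘ suc)) ⟩
    ∑ (suc (suc m)) (t m N) - ∑ (suc m) (t m (N ∸ 1))
      ≡⟨ cong (_- ∑ (suc m) (t m (N ∸ 1))) (∑-suc (suc m) (t m N)) ⟩
    (∑ (suc m) (t m N) + t m N (suc m)) - ∑ (suc m) (t m (N ∸ 1))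
      ≡⟨ cong (λ z → (∑ (suc m) (t m N) + z) - ∑ (suc m) (t m (N ∸ 1))) (alternatingTerm-vanishes m N) ⟩
    (∑ (suc m) (t m N) + + 0) - ∑ (suc m) (t m (N ∸ 1))
      ≡⟨ cong₂ (λ u v → (u + + 0) - v) (∑alternatingTerm≡∇fact m N) (∑alternatingTerm≡∇fact m (N ∸ 1)) ⟩
    (∇fact m N + + 0) - ∇fact m (N ∸ 1)
      ≡⟨ cong (_- ∇fact m (N ∸ 1)) (ℤ.+-identityʳ (∇fact m N)) ⟩
    ∇fact (suc m) N ∎
    where
    open ≡-Reasoning
    t : ℕ → ℕ → ℕ → ℤ
    t = alternatingTerm
    rearrange : ∀ a s b → a + (- s + b) ≡ (a + b) - s
    rearrange = solve-∀

  formula≡∇fact : ∀ n k → formula n k ≡ ∇fact (n ∸ k) n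
  formula≡∇fact n k =
    trans (foldr-map-applyUpTo≡∑ (alternatingTerm (n ∸ k) n) (λ j → j) (suc (n ∸ k)))
          (∑alternatingTerm≡∇fact (n ∸ k) n)

open AlternatingSum using (∇fact; formula≡∇fact)

open import Data.Nat as ℕ using (ℕ; zero; suc; _+_; _*_; _∸_; _!; _≤_; _<_; z≤n; s≤s; _≟_)
import Data.Nat.Properties as ℕ
open import Data.Integer as ℤ using (+_; _-_)
import Data.Integer.Properties as ℤ
open import Data.List using (List; []; _∷_; _++_; [_]; map; filter; length; concatMap; drop; applyUpTo)
open import Data.List.Properties
  using (length-map; length-++; ∷-injectiveˡ; ∷-injectiveʳ; filter-all; filter-accept; filter-reject;
         map-∘; length-applyUpTo; map-applyUpTo)
open import Data.List.Relation.Unary.All as All using (All; []; _∷_)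
import Data.List.Relation.Unary.All.Properties as All
open import Data.List.Relation.Unary.Any using (here; there)
open import Data.List.Relation.Unary.AllPairs as AllPairs using ([]; _∷_)
open import Data.List.Relation.Unary.Unique.Propositional using (Unique)
open import Data.List.Relation.Unary.Unique.Propositional.Properties as Unique using (Unique[x∷xs]⇒x∉xs)
open import Data.List.Membership.Propositional using (_∈_; _∉_; find; lose)
open import Data.List.Membership.Propositional.Properties
  using (∈-∃++; ∈-++⁻; ∈-++⁺ˡ; ∈-++⁺ʳ; ∈-filter⁻; ∈-filter⁺; ∈-map⁻; ∈-map⁺; ∈-concatMap⁻; ∈-concatMap⁺;
         ∈-applyUpTo⁺; ∈-applyUpTo⁻)
open import Data.List.Relation.Binary.Permutation.Propositional
  using (_↭_; prep; swap; ↭-refl; ↭-sym; ↭-trans; ↭-reflexive; ↭⇒↭ₛ; module PermutationReasoning)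
open import Data.List.Relation.Binary.Permutation.Propositional.Properties
  using (shift; ↭-length; filter-↭; ∈-resp-↭; drop-mid; drop-∷; ↭-empty-inv)
import Data.List.Relation.Binary.Permutation.Setoid.Properties as Permutationₛ
open import Data.Product as Product using (Σ; _×_; _,_; proj₁; proj₂)
open import Data.Sum using (_⊎_; inj₁; inj₂)
open import Data.Empty using (⊥; ⊥-elim)
open import Function using (_∘_)
open import Function.Bundles using (mk⇔; Equivalence)
open import Relation.Binary.PropositionalEquality hiding ([_])
open import Relation.Nullary using (¬_; Dec; yes; no; ¬?)
open import Relation.Nullary.Decidable using (_×-dec_; _⊎-dec_)
open import Relation.Unary using (Decidable)

-- Counting by duplicate-free enumerations

Unique-resp-↭ : ∀ {A : Set} {xs ys : List A} → xs ↭ ys → Unique xs → Unique ys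
Unique-resp-↭ {A} p = Permutationₛ.Unique-resp-↭ (setoid A) (↭⇒↭ₛ p)

Unique⊆⇒length≤ : ∀ {A : Set} {xs ys : List A} → Unique xs → Unique ys →
  (∀ {z} → z ∈ xs → z ∈ ys) → length xs ≤ length ys
Unique⊆⇒length≤ {xs = []}     _              _   _  = z≤n
Unique⊆⇒length≤ {xs = x ∷ xs} (x∉xs ∷ !xs) !ys xs⊆ys with ∈-∃++ (xs⊆ys (here refl))
... | us , vs , refl = begin
  suc (length xs)        ≤⟨ s≤s (Unique⊆⇒length≤ !xs !us++vs xs⊆us++vs) ⟩
  suc (length (us ++ vs)) ≡⟨ ↭-length (shift x us vs) ⟨
  length (us ++ x ∷ vs)  ∎
  where
  open ℕ.≤-Reasoning
  !us++vs : Unique (us ++ vs)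
  !us++vs with _ ∷ ! ← Unique-resp-↭ (shift x us vs) !ys = !
  xs⊆us++vs : ∀ {z} → z ∈ xs → z ∈ us ++ vs
  xs⊆us++vs {z} z∈xs with ∈-++⁻ us (xs⊆ys (there z∈xs))
  ... | inj₁ z∈us          = ∈-++⁺ˡ z∈us
  ... | inj₂ (here refl)   = ⊥-elim (All.lookup x∉xs z∈xs refl)
  ... | inj₂ (there z∈vs)  = ∈-++⁺ʳ us z∈vs

HasCount-unique : ∀ {P : List ℕ → Set} {M N} → HasCount P M → HasCount P N → M ≡ N
HasCount-unique (cs , !cs , cs⇔P , refl) (ds , !ds , ds⇔P , refl) = ℕ.≤-antisym
  (Unique⊆⇒length≤ !cs !ds (λ {w} → Equivalence.from (ds⇔P w) ∘ Equivalence.to (cs⇔P w)))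
  (Unique⊆⇒length≤ !ds !cs (λ {w} → Equivalence.from (cs⇔P w) ∘ Equivalence.to (ds⇔P w)))

HasCount-cong : ∀ {P Q : List ℕ → Set} {N} →
  (∀ w → P w → Q w) → (∀ w → Q w → P w) → HasCount P N → HasCount Q N
HasCount-cong P⇒Q Q⇒P (cs , !cs , cs⇔P , |cs|) =
  cs , !cs , (λ w → mk⇔ (P⇒Q w ∘ Equivalence.to (cs⇔P w)) (Equivalence.from (cs⇔P w) ∘ Q⇒P w)) , |cs|

length-filter-+-filter-∁ : ∀ {A : Set} {S : A → Set} (S? : Decidable S) xs →
  length (filter S? xs) + length (filter (¬? ∘ S?) xs) ≡ length xs
length-filter-+-filter-∁ S? []       = refl
length-filter-+-filter-∁ S? (x ∷ xs) with S? x
... | yes _ = cong suc (length-filter-+-filter-∁ S? xs)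
... | no  _ = trans (ℕ.+-suc _ _) (cong suc (length-filter-+-filter-∁ S? xs))

HasCount-partition : ∀ {P S : List ℕ → Set} {N} → Decidable S → HasCount P N →
  Σ ℕ λ N₁ → Σ ℕ λ N₂ →
    HasCount (λ w → P w × S w) N₁ × HasCount (λ w → P w × ¬ S w) N₂ × (N₁ + N₂ ≡ N)
HasCount-partition {P} S? (cs , !cs , cs⇔P , refl) =
  _ , _ , restrict S? , restrict (¬? ∘ S?) , length-filter-+-filter-∁ S? cs
  where
  restrict : ∀ {T : List ℕ → Set} (T? : Decidable T) → HasCount (λ w → P w × T w) (length (filter T? cs))
  restrict T? = filter T? cs , Unique.filter⁺ T? !cs ,
    (λ w → mk⇔ (λ w∈ → let (w∈cs , Tw) = ∈-filter⁻ T? w∈ in Equivalence.to (cs⇔P w) w∈cs , Tw)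
               (λ (Pw , Tw) → ∈-filter⁺ T? (Equivalence.from (cs⇔P w) Pw) Tw)) ,
    refl

map-Unique : ∀ {A B : Set} (f : B → A) (g : A → B) {xs} →
  (∀ {x} → x ∈ xs → f (g x) ≡ x) → Unique xs → Unique (map g xs)
map-Unique f g {[]}     fg≗id []           = []
map-Unique f g {x ∷ xs} fg≗id (x∉xs ∷ !xs) =
  All.map⁺ (All.tabulate λ {y} y∈xs gx≡gy → All.lookup x∉xs y∈xs
    (trans (sym (fg≗id (here refl))) (trans (cong f gx≡gy) (fg≗id (there y∈xs)))))
  ∷ map-Unique f g (fg≗id ∘ there) !xs

HasCount-inverse : ∀ {P Q : List ℕ → Set} {N} (f g : List ℕ → List ℕ) →
  (∀ y → Q y → P (g y)) → (∀ x → P x → Q (f x)) →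
  (∀ y → Q y → f (g y) ≡ y) → (∀ x → P x → g (f x) ≡ x) →
  HasCount Q N → HasCount P N
HasCount-inverse {P} f g g∈P f∈Q fg gf (cs , !cs , cs⇔Q , refl) =
  map g cs , map-Unique f g (λ {y} y∈cs → fg y (Equivalence.to (cs⇔Q y) y∈cs)) !cs ,
  (λ x → mk⇔ (λ x∈ → let (y , y∈cs , x≡gy) = ∈-map⁻ g x∈ in
                      subst P (sym x≡gy) (g∈P y (Equivalence.to (cs⇔Q y) y∈cs)))
             (λ Px → subst (_∈ map g cs) (gf x Px) (∈-map⁺ g (Equivalence.from (cs⇔Q (f x)) (f∈Q x Px))))) ,
  length-map g cs

-- Consecutive letters; deleting and inserting a letter

StartsWith : List ℕ → ℕ → Set
StartsWith []      b = ⊥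
StartsWith (x ∷ _) b = x ≡ b

Consecutive : List ℕ → ℕ → ℕ → Set
Consecutive []       a b = ⊥
Consecutive (x ∷ xs) a b = (x ≡ a × StartsWith xs b) ⊎ Consecutive xs a b

startsWith? : ∀ w b → Dec (StartsWith w b)
startsWith? []      b = no λ ()
startsWith? (x ∷ _) b = x ≟ b

consecutive? : ∀ w a b → Dec (Consecutive w a b)
consecutive? []       a b = no λ ()
consecutive? (x ∷ xs) a b = ((x ≟ a) ×-dec startsWith? xs b) ⊎-dec consecutive? xs a b

Adjacent⇒Consecutive : ∀ {w a b} → Adjacent w a b → Consecutive w a b
Adjacent⇒Consecutive (xs , ys , refl) = go xs
  where
  go : ∀ xs {a b ys} → Consecutive (xs ++ a ∷ b ∷ ys) a b
  go []       = inj₁ (refl , refl)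
  go (x ∷ xs) = inj₂ (go xs)

Consecutive⇒Adjacent : ∀ w {a b} → Consecutive w a b → Adjacent w a b
Consecutive⇒Adjacent (x ∷ y ∷ zs) (inj₁ (refl , refl)) = [] , zs , refl
Consecutive⇒Adjacent (x ∷ xs)     (inj₂ ab) with us , vs , refl ← Consecutive⇒Adjacent xs ab =
  x ∷ us , vs , refl

Consecutive-∷ʳ⁻ : ∀ w {c a b} → b ≢ c → Consecutive (w ++ [ c ]) a b → Consecutive w a b
Consecutive-∷ʳ⁻ []           b≢c (inj₂ ())
Consecutive-∷ʳ⁻ (x ∷ [])     b≢c (inj₁ (_ , c≡b)) = ⊥-elim (b≢c (sym c≡b))
Consecutive-∷ʳ⁻ (x ∷ [])     b≢c (inj₂ (inj₂ ()))
Consecutive-∷ʳ⁻ (x ∷ y ∷ zs) b≢c (inj₁ ab)        = inj₁ ab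
Consecutive-∷ʳ⁻ (x ∷ y ∷ zs) b≢c (inj₂ ab)        = inj₂ (Consecutive-∷ʳ⁻ (y ∷ zs) b≢c ab)

Consecutive-∷ʳ⁺ : ∀ w {c a b} → Consecutive w a b → Consecutive (w ++ [ c ]) a b
Consecutive-∷ʳ⁺ (x ∷ y ∷ zs) (inj₁ ab) = inj₁ ab
Consecutive-∷ʳ⁺ (x ∷ xs)     (inj₂ ab) = inj₂ (Consecutive-∷ʳ⁺ xs ab)

StartsWith⇒∈ : ∀ {w b} → StartsWith w b → b ∈ w
StartsWith⇒∈ {_ ∷ _} refl = here refl

Consecutive⇒∈ˡ : ∀ {w a b} → Consecutive w a b → a ∈ w
Consecutive⇒∈ˡ {_ ∷ _} (inj₁ (refl , _)) = here refl
Consecutive⇒∈ˡ {_ ∷ _} (inj₂ ab)         = there (Consecutive⇒∈ˡ ab)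

Consecutive⇒∈ʳ : ∀ {w a b} → Consecutive w a b → b ∈ w
Consecutive⇒∈ʳ {_ ∷ _} (inj₁ (_ , b)) = there (StartsWith⇒∈ b)
Consecutive⇒∈ʳ {_ ∷ _} (inj₂ ab)      = there (Consecutive⇒∈ʳ ab)

Consecutive-functional : ∀ {w a b b′} → Unique w → Consecutive w a b → Consecutive w a b′ → b ≡ b′
Consecutive-functional {_ ∷ _ ∷ _} _    (inj₁ (_ , refl)) (inj₁ (_ , refl)) = refl
Consecutive-functional {_ ∷ _}     !w   (inj₁ (refl , _)) (inj₂ ab′)        =
  ⊥-elim (Unique[x∷xs]⇒x∉xs !w (Consecutive⇒∈ˡ ab′))
Consecutive-functional {_ ∷ _}     !w   (inj₂ ab)         (inj₁ (refl , _)) =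
  ⊥-elim (Unique[x∷xs]⇒x∉xs !w (Consecutive⇒∈ˡ ab))
Consecutive-functional {_ ∷ _}     (_ ∷ !w) (inj₂ ab)     (inj₂ ab′)        = Consecutive-functional !w ab ab′

¬Consecutive-into-head : ∀ {y zs a} → Unique (y ∷ zs) → ¬ Consecutive (y ∷ zs) a y
¬Consecutive-into-head !w (inj₁ (_ , y∈zs)) = Unique[x∷xs]⇒x∉xs !w (StartsWith⇒∈ y∈zs)
¬Consecutive-into-head !w (inj₂ ay)         = Unique[x∷xs]⇒x∉xs !w (Consecutive⇒∈ʳ ay)

Consecutive-injective : ∀ {w a a′ b} → Unique w → Consecutive w a b → Consecutive w a′ b → a ≡ a′
Consecutive-injective {_ ∷ _}     _        (inj₁ (refl , _))  (inj₁ (refl , _))  = refl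
Consecutive-injective {_ ∷ _ ∷ _} (_ ∷ !w) (inj₁ (_ , refl))  (inj₂ a′b)         = ⊥-elim (¬Consecutive-into-head !w a′b)
Consecutive-injective {_ ∷ _ ∷ _} (_ ∷ !w) (inj₂ ab)          (inj₁ (_ , refl))  = ⊥-elim (¬Consecutive-into-head !w ab)
Consecutive-injective {_ ∷ _}     (_ ∷ !w) (inj₂ ab)          (inj₂ a′b)         = Consecutive-injective !w ab a′b

delete : ℕ → List ℕ → List ℕ
delete b = filter (λ z → ¬? (z ≟ b))

delete-∉ : ∀ {b l} → b ∉ l → delete b l ≡ l
delete-∉ {b} b∉l = filter-all (λ z → ¬? (z ≟ b)) (All.tabulate λ z∈l z≡b → b∉l (subst (_∈ _) z≡b z∈l))

∉-delete : ∀ b l → b ∉ delete b l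
∉-delete b l b∈ = proj₂ (∈-filter⁻ (λ z → ¬? (z ≟ b)) {xs = l} b∈) refl

∈-delete⁻ : ∀ {b l z} → z ∈ delete b l → z ∈ l
∈-delete⁻ {b} z∈ = proj₁ (∈-filter⁻ (λ z → ¬? (z ≟ b)) z∈)

∈-delete⁺ : ∀ {b l z} → z ∈ l → z ≢ b → z ∈ delete b l
∈-delete⁺ {b} = ∈-filter⁺ (λ z → ¬? (z ≟ b))

Unique-delete : ∀ b {l} → Unique l → Unique (delete b l)
Unique-delete b = Unique.filter⁺ (λ z → ¬? (z ≟ b))

delete-↭ : ∀ b {l l′} → l ↭ l′ → delete b l ↭ delete b l′
delete-↭ b = filter-↭ (λ z → ¬? (z ≟ b))

delete-head : ∀ b zs → delete b (b ∷ zs) ≡ delete b zs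
delete-head b zs = filter-reject (λ z → ¬? (z ≟ b)) (λ b≢b → b≢b refl)

delete-∷ : ∀ {b z} zs → z ≢ b → delete b (z ∷ zs) ≡ z ∷ delete b zs
delete-∷ {b} zs = filter-accept (λ z → ¬? (z ≟ b))

↭-delete : ∀ {b l} → Unique l → b ∈ l → l ↭ b ∷ delete b l
↭-delete {b} {z ∷ zs} !l (here refl) =
  prep b (↭-reflexive (sym (trans (delete-head b zs) (delete-∉ (Unique[x∷xs]⇒x∉xs !l)))))
↭-delete {b} {z ∷ zs} (z∉zs ∷ !zs) (there b∈zs) = begin
  z ∷ zs               ↭⟨ prep z (↭-delete !zs b∈zs) ⟩
  z ∷ b ∷ delete b zs  ↭⟨ swap z b ↭-refl ⟩
  b ∷ z ∷ delete b zs  ≡⟨ cong (b ∷_) (delete-∷ zs z≢b) ⟨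
  b ∷ delete b (z ∷ zs) ∎
  where
  open PermutationReasoning
  z≢b : z ≢ b
  z≢b refl = Unique[x∷xs]⇒x∉xs (z∉zs ∷ !zs) b∈zs

insertAfter : ℕ → ℕ → List ℕ → List ℕ
insertAfter a b []       = []
insertAfter a b (z ∷ zs) with z ≟ a
... | yes _ = z ∷ b ∷ zs
... | no  _ = z ∷ insertAfter a b zs

insertAfter-↭ : ∀ {a} b {l} → a ∈ l → insertAfter a b l ↭ b ∷ l
insertAfter-↭ {a} b {z ∷ zs} a∈l with z ≟ a
... | yes _ = swap z b ↭-refl
insertAfter-↭ {a} b {z ∷ zs} (here a≡z)   | no z≢a = ⊥-elim (z≢a (sym a≡z))
insertAfter-↭ {a} b {z ∷ zs} (there a∈zs) | no z≢a = ↭-trans (prep z (insertAfter-↭ b a∈zs)) (swap z b ↭-refl)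

Consecutive-insertAfter : ∀ {a} b {l} → a ∈ l → Consecutive (insertAfter a b l) a b
Consecutive-insertAfter {a} b {z ∷ zs} a∈l with z ≟ a
... | yes z≡a = inj₁ (z≡a , refl)
Consecutive-insertAfter {a} b {z ∷ zs} (here a≡z)   | no z≢a = ⊥-elim (z≢a (sym a≡z))
Consecutive-insertAfter {a} b {z ∷ zs} (there a∈zs) | no z≢a = inj₂ (Consecutive-insertAfter b a∈zs)

delete-insertAfter : ∀ {a b} l → a ≢ b → b ∉ l → delete b (insertAfter a b l) ≡ l
delete-insertAfter         []       a≢b b∉l = refl
delete-insertAfter {a} {b} (z ∷ zs) a≢b b∉l with z ≟ a
... | yes refl = begin
  delete b (z ∷ b ∷ zs) ≡⟨ delete-∷ (b ∷ zs) a≢b ⟩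
  z ∷ delete b (b ∷ zs) ≡⟨ cong (z ∷_) (trans (delete-head b zs) (delete-∉ (b∉l ∘ there))) ⟩
  z ∷ zs                ∎
  where open ≡-Reasoning
... | no _ = trans (delete-∷ (insertAfter a b zs) z≢b) (cong (z ∷_) (delete-insertAfter zs a≢b (b∉l ∘ there)))
  where
  z≢b : z ≢ b
  z≢b refl = b∉l (here refl)

insertAfter-delete : ∀ {a b} l → Unique l → Consecutive l a b → insertAfter a b (delete b l) ≡ l
insertAfter-delete {a} {b} (z ∷ zs) !l ab with z ≟ b
... | yes refl = ⊥-elim (¬Consecutive-into-head !l ab)
... | no z≢b rewrite delete-∷ zs z≢b with z ≟ a
insertAfter-delete {a} {b} (z ∷ b ∷ ys) (_ ∷ !bys) (inj₁ (_ , refl)) | no z≢b | yes _ =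
  cong (λ t → z ∷ b ∷ t) (trans (delete-head b ys) (delete-∉ (Unique[x∷xs]⇒x∉xs !bys)))
insertAfter-delete (z ∷ zs) !l (inj₂ ab)         | no _ | yes refl = ⊥-elim (Unique[x∷xs]⇒x∉xs !l (Consecutive⇒∈ˡ ab))
insertAfter-delete (z ∷ zs) !l (inj₁ (refl , _)) | no _ | no z≢a   = ⊥-elim (z≢a refl)
insertAfter-delete (z ∷ zs) (_ ∷ !zs) (inj₂ ab)  | no _ | no _     = cong (z ∷_) (insertAfter-delete zs !zs ab)

StartsWith-delete⁻ : ∀ {b q} l → Unique l → StartsWith (delete b l) q →
  StartsWith l q ⊎ (StartsWith l b × Consecutive l b q)
StartsWith-delete⁻ {b} (y ∷ l) !l s with y ≟ b
... | yes refl rewrite delete-head y l | delete-∉ (Unique[x∷xs]⇒x∉xs !l) = inj₂ (refl , inj₁ (refl , s))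
... | no y≢b   rewrite delete-∷ l y≢b = inj₁ s

StartsWith-delete⁺ : ∀ {b q} l → Unique l → q ≢ b →
  StartsWith l q ⊎ (StartsWith l b × Consecutive l b q) → StartsWith (delete b l) q
StartsWith-delete⁺ []      _  _   (inj₁ ())
StartsWith-delete⁺ []      _  _   (inj₂ (() , _))
StartsWith-delete⁺ {b} (y ∷ l) !l q≢b s with y ≟ b
StartsWith-delete⁺ {b} (y ∷ l) !l q≢b (inj₁ refl)                  | yes refl = ⊥-elim (q≢b refl)
StartsWith-delete⁺ {b} (y ∷ l) !l q≢b (inj₂ (_ , inj₁ (_ , s)))    | yes refl
  rewrite delete-head y l | delete-∉ (Unique[x∷xs]⇒x∉xs !l) = s
StartsWith-delete⁺ {b} (y ∷ l) !l q≢b (inj₂ (_ , inj₂ bq))         | yes refl = ⊥-elim (Unique[x∷xs]⇒x∉xs !l (Consecutive⇒∈ˡ bq))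
StartsWith-delete⁺ {b} (y ∷ l) !l q≢b (inj₁ s)                     | no y≢b rewrite delete-∷ l y≢b = s
StartsWith-delete⁺ {b} (y ∷ l) !l q≢b (inj₂ (y≡b , _))             | no y≢b = ⊥-elim (y≢b y≡b)

Consecutive-delete⁻ : ∀ {b p q} l → Unique l → Consecutive (delete b l) p q →
  Consecutive l p q ⊎ (Consecutive l p b × Consecutive l b q)
Consecutive-delete⁻ {b} (z ∷ zs) !l pq with z ≟ b
... | yes refl rewrite delete-head z zs | delete-∉ (Unique[x∷xs]⇒x∉xs !l) = inj₁ (inj₂ pq)
... | no z≢b   rewrite delete-∷ zs z≢b with !l | pq
...   | _ ∷ !zs | inj₁ (z≡p , s) with StartsWith-delete⁻ zs !zs s
...     | inj₁ s′         = inj₁ (inj₁ (z≡p , s′))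
...     | inj₂ (s′ , bq) = inj₂ (inj₁ (z≡p , s′) , inj₂ bq)
Consecutive-delete⁻ {b} (z ∷ zs) !l pq | no z≢b | _ ∷ !zs | inj₂ pq′ with Consecutive-delete⁻ zs !zs pq′
...     | inj₁ pq″         = inj₁ (inj₂ pq″)
...     | inj₂ (pb , bq)   = inj₂ (inj₂ pb , inj₂ bq)

Consecutive-delete⁺ : ∀ {b p q} l → Unique l → p ≢ b → q ≢ b →
  Consecutive l p q ⊎ (Consecutive l p b × Consecutive l b q) → Consecutive (delete b l) p q
Consecutive-delete⁺ []       _ _ _ (inj₁ ())
Consecutive-delete⁺ []       _ _ _ (inj₂ (() , _))
Consecutive-delete⁺ {b} (z ∷ zs) !l p≢b q≢b c with z ≟ b
Consecutive-delete⁺ {b} (z ∷ zs) !l p≢b q≢b (inj₁ (inj₁ (z≡p , _)))     | yes refl = ⊥-elim (p≢b (sym z≡p))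
Consecutive-delete⁺ {b} (z ∷ zs) !l p≢b q≢b (inj₁ (inj₂ pq))           | yes refl
  rewrite delete-head z zs | delete-∉ (Unique[x∷xs]⇒x∉xs !l) = pq
Consecutive-delete⁺ {b} (z ∷ zs) !l p≢b q≢b (inj₂ (inj₁ (z≡p , _) , _)) | yes refl = ⊥-elim (p≢b (sym z≡p))
Consecutive-delete⁺ {b} (z ∷ zs) !l p≢b q≢b (inj₂ (inj₂ pb , _))       | yes refl = ⊥-elim (Unique[x∷xs]⇒x∉xs !l (Consecutive⇒∈ʳ pb))
Consecutive-delete⁺ {b} (z ∷ zs) (_ ∷ !zs) p≢b q≢b c | no z≢b rewrite delete-∷ zs z≢b with c
... | inj₁ (inj₁ (z≡p , s))            = inj₁ (z≡p , StartsWith-delete⁺ zs !zs q≢b (inj₁ s))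
... | inj₁ (inj₂ pq)                   = inj₂ (Consecutive-delete⁺ zs !zs p≢b q≢b (inj₁ pq))
... | inj₂ (_ , inj₁ (z≡b , _))        = ⊥-elim (z≢b z≡b)
... | inj₂ (inj₁ (z≡p , s) , inj₂ bq)  = inj₁ (z≡p , StartsWith-delete⁺ zs !zs q≢b (inj₂ (s , bq)))
... | inj₂ (inj₂ pb , inj₂ bq)         = inj₂ (Consecutive-delete⁺ zs !zs p≢b q≢b (inj₂ (pb , bq)))

-- Enumerating permutations

insertions : ℕ → List ℕ → List (List ℕ)
insertions x []       = [ [ x ] ]
insertions x (y ∷ ys) = (x ∷ y ∷ ys) ∷ map (y ∷_) (insertions x ys)

permutations : List ℕ → List (List ℕ)
permutations []       = [ [] ]
permutations (x ∷ xs) = concatMap (insertions x) (permutations xs)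

length-insertions : ∀ x ys → length (insertions x ys) ≡ suc (length ys)
length-insertions x []       = refl
length-insertions x (y ∷ ys) = cong suc (trans (length-map (y ∷_) (insertions x ys)) (length-insertions x ys))

∈-insertions⁻ : ∀ x ys {w} → w ∈ insertions x ys → w ↭ x ∷ ys
∈-insertions⁻ x []       (here refl) = ↭-refl
∈-insertions⁻ x (y ∷ ys) (here refl) = ↭-refl
∈-insertions⁻ x (y ∷ ys) (there w∈) with v , v∈ , refl ← ∈-map⁻ (y ∷_) w∈ =
  ↭-trans (prep y (∈-insertions⁻ x ys v∈)) (swap y x ↭-refl)

∈-insertions⁺ : ∀ x us vs → us ++ x ∷ vs ∈ insertions x (us ++ vs)
∈-insertions⁺ x []       []       = here refl
∈-insertions⁺ x []       (v ∷ vs) = here refl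
∈-insertions⁺ x (u ∷ us) vs       = there (∈-map⁺ (u ∷_) (∈-insertions⁺ x us vs))

Unique-insertions : ∀ x ys → x ∉ ys → Unique (insertions x ys)
Unique-insertions x []       _    = [] ∷ []
Unique-insertions x (y ∷ ys) x∉ys =
  All.map⁺ (All.tabulate λ _ x∷≡y∷ → x∉ys (here (∷-injectiveˡ x∷≡y∷))) ∷
  Unique.map⁺ ∷-injectiveʳ (Unique-insertions x ys (x∉ys ∘ there))

delete-insertions : ∀ x ys {w} → x ∉ ys → w ∈ insertions x ys → delete x w ≡ ys
delete-insertions x []       _    (here refl) = delete-head x []
delete-insertions x (y ∷ ys) x∉ys (here refl) = trans (delete-head x (y ∷ ys)) (delete-∉ x∉ys)
delete-insertions x (y ∷ ys) x∉ys (there w∈) with w′ , w′∈ , refl ← ∈-map⁻ (y ∷_) w∈ =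
  trans (delete-∷ w′ (λ y≡x → x∉ys (here (sym y≡x)))) (cong (y ∷_) (delete-insertions x ys (x∉ys ∘ there) w′∈))

∈-permutations⁻ : ∀ xs {w} → w ∈ permutations xs → w ↭ xs
∈-permutations⁻ []       (here refl) = ↭-refl
∈-permutations⁻ (x ∷ xs) w∈ with v , v∈ , w∈ins ← find (∈-concatMap⁻ (insertions x) {xs = permutations xs} w∈) =
  ↭-trans (∈-insertions⁻ x v w∈ins) (prep x (∈-permutations⁻ xs v∈))

∈-permutations⁺ : ∀ xs {w} → w ↭ xs → w ∈ permutations xs
∈-permutations⁺ []       w↭[] rewrite ↭-empty-inv w↭[] = here refl
∈-permutations⁺ (x ∷ xs) w↭ with us , vs , refl ← ∈-∃++ (∈-resp-↭ (↭-sym w↭) (here refl)) =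
  ∈-concatMap⁺ (insertions x) {xs = permutations xs}
    (lose (∈-permutations⁺ xs (drop-mid us [] w↭)) (∈-insertions⁺ x us vs))

Unique-concatMap-insertions : ∀ x vs → Unique vs → All (x ∉_) vs → Unique (concatMap (insertions x) vs)
Unique-concatMap-insertions x []       _            _           = []
Unique-concatMap-insertions x (v ∷ vs) (v∉vs ∷ !vs) (x∉v ∷ x∉vs) =
  Unique.++⁺ (Unique-insertions x v x∉v) (Unique-concatMap-insertions x vs !vs x∉vs) disjoint
  where
  disjoint : ∀ {w} → ¬ (w ∈ insertions x v × w ∈ concatMap (insertions x) vs)
  disjoint (w∈ , w∈′) with v′ , v′∈vs , w∈ins′ ← find (∈-concatMap⁻ (insertions x) {xs = vs} w∈′) =
    Unique[x∷xs]⇒x∉xs (v∉vs ∷ !vs) (subst (_∈ vs)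
      (trans (sym (delete-insertions x v′ (All.lookup x∉vs v′∈vs) w∈ins′)) (delete-insertions x v x∉v w∈)) v′∈vs)

Unique-permutations : ∀ xs → Unique xs → Unique (permutations xs)
Unique-permutations []       _            = [] ∷ []
Unique-permutations (x ∷ xs) (x∉xs ∷ !xs) =
  Unique-concatMap-insertions x (permutations xs) (Unique-permutations xs !xs)
    (All.tabulate λ v∈ x∈v → Unique[x∷xs]⇒x∉xs (x∉xs ∷ !xs) (∈-resp-↭ (∈-permutations⁻ xs v∈) x∈v))

length-concatMap-insertions : ∀ x n vs → All (λ v → length v ≡ n) vs →
  length (concatMap (insertions x) vs) ≡ length vs * suc n
length-concatMap-insertions x n []       _            = refl
length-concatMap-insertions x n (v ∷ vs) (|v| ∷ |vs|) =
  trans (length-++ (insertions x v))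
        (cong₂ _+_ (trans (length-insertions x v) (cong suc |v|)) (length-concatMap-insertions x n vs |vs|))

length-permutations : ∀ xs → length (permutations xs) ≡ length xs !
length-permutations []       = refl
length-permutations (x ∷ xs) = begin
  length (concatMap (insertions x) (permutations xs))
    ≡⟨ length-concatMap-insertions x (length xs) (permutations xs)
         (All.tabulate (↭-length ∘ ∈-permutations⁻ xs)) ⟩
  length (permutations xs) * suc (length xs)
    ≡⟨ cong (_* suc (length xs)) (length-permutations xs) ⟩
  length xs ! * suc (length xs)
    ≡⟨ ℕ.*-comm (length xs !) (suc (length xs)) ⟩
  suc (length xs) !  ∎
  where open ≡-Reasoning

HasCount-↭ : ∀ xs → Unique xs → HasCount (_↭ xs) (length xs !)
HasCount-↭ xs !xs =
  permutations xs , Unique-permutations xs !xs ,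
  (λ w → mk⇔ (∈-permutations⁻ xs) (∈-permutations⁺ xs)) , length-permutations xs

-- Words avoiding forbidden pairs

Pairs : Set
Pairs = List (ℕ × ℕ)

Avoids : Pairs → List ℕ → Set
Avoids P w = All (λ (p , q) → ¬ Consecutive w p q) P

-- The circular permutations of h ∷ R, written starting from h.
HeadedBy : ℕ → List ℕ → List ℕ → Set
HeadedBy h R w = Σ (List ℕ) λ r → w ≡ h ∷ r × r ↭ R

Admissible : ℕ → List ℕ → Pairs → List ℕ → Set
Admissible h R P w = HeadedBy h R w × Avoids P w

Unique-HeadedBy : ∀ {h R w} → h ∉ R → Unique R → HeadedBy h R w → Unique w
Unique-HeadedBy h∉R !R (r , refl , r↭R) =
  All.tabulate (λ h′∈r h≡h′ → h∉R (∈-resp-↭ r↭R (subst (_∈ r) (sym h≡h′) h′∈r)))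
  ∷ Unique-resp-↭ (↭-sym r↭R) !R

∈-HeadedBy : ∀ {h R w z} → HeadedBy h R w → z ∈ h ∷ R → z ∈ w
∈-HeadedBy (r , refl , r↭R) (here z≡h)  = here z≡h
∈-HeadedBy (r , refl , r↭R) (there z∈R) = there (∈-resp-↭ (↭-sym r↭R) z∈R)

HeadedBy-resp-↭ : ∀ {h R R′ w} → R ↭ R′ → HeadedBy h R w → HeadedBy h R′ w
HeadedBy-resp-↭ R↭R′ (r , w≡h∷r , r↭R) = r , w≡h∷r , ↭-trans r↭R R↭R′

HeadedBy-insertAfter : ∀ {h R a} b {w} → HeadedBy h R w → a ∈ w → HeadedBy h (b ∷ R) (insertAfter a b w)
HeadedBy-insertAfter {h} {a = a} b (r , refl , r↭R) a∈w with h ≟ a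
... | yes _ = b ∷ r , refl , prep b r↭R
HeadedBy-insertAfter b (r , refl , r↭R) (here a≡h)  | no h≢a = ⊥-elim (h≢a (sym a≡h))
HeadedBy-insertAfter b (r , refl , r↭R) (there a∈r) | no _   =
  insertAfter _ b r , refl , ↭-trans (insertAfter-↭ b a∈r) (prep b r↭R)

HeadedBy-delete : ∀ {h R w} b → h ≢ b → HeadedBy h R w → HeadedBy h (delete b R) (delete b w)
HeadedBy-delete b h≢b (r , refl , r↭R) = delete b r , delete-∷ r h≢b , delete-↭ b r↭R

_[_↦_] : ℕ → ℕ → ℕ → ℕ
p [ b ↦ a ] with p ≟ b
... | yes _ = a
... | no  _ = p

[↦]-inverse : ∀ a b {x} → x ≢ a → (x [ b ↦ a ]) [ a ↦ b ] ≡ x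
[↦]-inverse a b {x} x≢a with x ≟ b
... | yes refl with a ≟ a
...   | yes _   = refl
...   | no a≢a  = ⊥-elim (a≢a refl)
[↦]-inverse a b {x} x≢a | no _ with x ≟ a
...   | yes x≡a = ⊥-elim (x≢a x≡a)
...   | no _    = refl

-- In a word where b follows a, deleting b makes a the predecessor of b's successor.
contract : ℕ → ℕ → Pairs → Pairs
contract a b = map (Product.map₁ (_[ b ↦ a ]))

module _ {a b w} (a≢b : a ≢ b) (!w : Unique w) (ab : Consecutive w a b) where

  Consecutive-contract⁺ : ∀ {p q} → p ≢ a → q ≢ b → Consecutive w p q → Consecutive (delete b w) (p [ b ↦ a ]) q
  Consecutive-contract⁺ {p} p≢a q≢b pq with p ≟ b
  ... | yes refl = Consecutive-delete⁺ w !w a≢b q≢b (inj₂ (ab , pq))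
  ... | no  p≢b  = Consecutive-delete⁺ w !w p≢b q≢b (inj₁ pq)

  Consecutive-contract⁻ : ∀ {p q} → p ≢ a → q ≢ b → Consecutive (delete b w) (p [ b ↦ a ]) q → Consecutive w p q
  Consecutive-contract⁻ {p} p≢a q≢b pq with p ≟ b
  Consecutive-contract⁻ {p} p≢a q≢b pq | yes refl with Consecutive-delete⁻ w !w pq
  ... | inj₁ aq       = ⊥-elim (q≢b (Consecutive-functional !w aq ab))
  ... | inj₂ (_ , bq) = bq
  Consecutive-contract⁻ {p} p≢a q≢b pq | no _ with Consecutive-delete⁻ w !w pq
  ... | inj₁ pq′      = pq′
  ... | inj₂ (pb , _) = ⊥-elim (p≢a (Consecutive-injective !w pb ab))

  Avoids-contract⁺ : ∀ P → All (λ (p , q) → p ≢ a × q ≢ b) P → Avoids P w → Avoids (contract a b P) (delete b w)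
  Avoids-contract⁺ []      []                  []           = []
  Avoids-contract⁺ (_ ∷ P) ((p≢a , q≢b) ∷ ok) (¬pq ∷ avoids) =
    ¬pq ∘ Consecutive-contract⁻ p≢a q≢b ∷ Avoids-contract⁺ P ok avoids

  Avoids-contract⁻ : ∀ P → All (λ (p , q) → p ≢ a × q ≢ b) P → Avoids (contract a b P) (delete b w) → Avoids P w
  Avoids-contract⁻ []      []                  []           = []
  Avoids-contract⁻ (_ ∷ P) ((p≢a , q≢b) ∷ ok) (¬pq ∷ avoids) =
    ¬pq ∘ Consecutive-contract⁺ p≢a q≢b ∷ Avoids-contract⁻ P ok avoids

record WellFormed (h : ℕ) (R : List ℕ) (P : Pairs) : Set where
  field
    h∉R      : h ∉ R
    !R       : Unique R
    -- p < q excludes cycles among the pairs, so contraction never creates a pair (a , a).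
    ordered  : All (λ (p , q) → p < q × p ∈ h ∷ R × q ∈ R) P
    !sources : Unique (map proj₁ P)
    !targets : Unique (map proj₂ P)

module _ {h R a b P} (wf : WellFormed h R ((a , b) ∷ P)) where
  open WellFormed wf

  a≢b : a ≢ b
  a≢b = ℕ.<⇒≢ (proj₁ (All.head ordered))

  b∈R : b ∈ R
  b∈R = proj₂ (proj₂ (All.head ordered))

  private
    R′ : List ℕ
    R′ = delete b R

    P′ : Pairs
    P′ = contract a b P

    h≢b : h ≢ b
    h≢b refl = h∉R b∈R

    ∈-h∷R′ : ∀ {z} → z ∈ h ∷ R → z ≢ b → z ∈ h ∷ R′
    ∈-h∷R′ z∈ z≢b = subst (_ ∈_) (delete-∷ R h≢b) (∈-delete⁺ z∈ z≢b)

    a∈h∷R′ : a ∈ h ∷ R′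
    a∈h∷R′ = ∈-h∷R′ (proj₁ (proj₂ (All.head ordered))) a≢b

    b∉ : ∀ {y} → HeadedBy h R′ y → b ∉ y
    b∉ (r , refl , r↭R′) (here b≡h)  = h≢b (sym b≡h)
    b∉ (r , refl , r↭R′) (there b∈r) = ∉-delete b R (∈-resp-↭ r↭R′ b∈r)

    apart : All (λ (p , q) → p ≢ a × q ≢ b) P
    apart = All.zipWith (λ (a≢p , b≢q) → a≢p ∘ sym , b≢q ∘ sym)
      (All.map⁻ (AllPairs.head !sources) , All.map⁻ (AllPairs.head !targets))

  WellFormed-tail : WellFormed h R P
  WellFormed-tail = record
    { h∉R = h∉R ; !R = !R ; ordered = All.tail ordered
    ; !sources = AllPairs.tail !sources ; !targets = AllPairs.tail !targets }

  WellFormed-contract : WellFormed h R′ P′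
  WellFormed-contract = record
    { h∉R      = h∉R ∘ ∈-delete⁻
    ; !R       = Unique-delete b !R
    ; ordered  = All.map⁺ (All.zipWith (λ (pq , p≢a×q≢b) → contract-ordered pq p≢a×q≢b) (All.tail ordered , apart))
    ; !sources = subst Unique (trans (sym (map-∘ P)) (map-∘ P))
        (map-Unique (_[ a ↦ b ]) (_[ b ↦ a ])
          (λ x∈ → [↦]-inverse a b (All.lookup (AllPairs.head !sources) x∈ ∘ sym)) (AllPairs.tail !sources))
    ; !targets = subst Unique (map-∘ P) (AllPairs.tail !targets) }
    where
    contract-ordered : ∀ {p q} → p < q × p ∈ h ∷ R × q ∈ R → p ≢ a × q ≢ b →
      p [ b ↦ a ] < q × p [ b ↦ a ] ∈ h ∷ R′ × q ∈ R′
    contract-ordered {p} (p<q , p∈ , q∈R) (p≢a , q≢b) with p ≟ b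
    ... | yes refl = ℕ.<-trans (proj₁ (All.head ordered)) p<q , a∈h∷R′ , ∈-delete⁺ q∈R q≢b
    ... | no  p≢b  = p<q , ∈-h∷R′ p∈ p≢b , ∈-delete⁺ q∈R q≢b

  insert-admissible : ∀ y → Admissible h R′ P′ y →
    Admissible h R P (insertAfter a b y) × Consecutive (insertAfter a b y) a b
  insert-admissible y (y-headed , y-avoids) = (headed , avoids) , ab
    where
    a∈y : a ∈ y
    a∈y = ∈-HeadedBy y-headed a∈h∷R′
    headed : HeadedBy h R (insertAfter a b y)
    headed = HeadedBy-resp-↭ (↭-sym (↭-delete !R b∈R)) (HeadedBy-insertAfter b y-headed a∈y)
    ab : Consecutive (insertAfter a b y) a b
    ab = Consecutive-insertAfter b a∈y
    avoids : Avoids P (insertAfter a b y)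
    avoids = Avoids-contract⁻ a≢b (Unique-HeadedBy h∉R !R headed) ab P apart
      (subst (Avoids P′) (sym (delete-insertAfter y a≢b (b∉ y-headed))) y-avoids)

  delete-admissible : ∀ x → Admissible h R P x × Consecutive x a b → Admissible h R′ P′ (delete b x)
  delete-admissible x ((x-headed , x-avoids) , ab) =
    HeadedBy-delete b h≢b x-headed ,
    Avoids-contract⁺ a≢b (Unique-HeadedBy h∉R !R x-headed) ab P apart x-avoids

  HasCount-Consecutive : ∀ {N} → HasCount (Admissible h R′ P′) N →
    HasCount (λ w → Admissible h R P w × Consecutive w a b) N
  HasCount-Consecutive = HasCount-inverse (delete b) (insertAfter a b) insert-admissible delete-admissible
    (λ y (y-headed , _) → delete-insertAfter y a≢b (b∉ y-headed))
    (λ x ((x-headed , _) , ab) → insertAfter-delete x (Unique-HeadedBy h∉R !R x-headed) ab)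

HasCount-Admissible-[] : ∀ h {R} → Unique R → HasCount (Admissible h R []) (length R !)
HasCount-Admissible-[] h {R} !R = HasCount-inverse (drop 1) (h ∷_)
  (λ r r↭R → (r , refl , r↭R) , [])
  (λ { _ ((r , refl , r↭R) , _) → r↭R })
  (λ _ _ → refl)
  (λ { _ ((r , refl , _) , _) → refl })
  (HasCount-↭ R !R)

+[m+n]-+m≡+n : ∀ m n → + (m + n) - + m ≡ + n
+[m+n]-+m≡+n m n = trans (ℤ.[+m]-[+n]≡m⊖n (m + n) m) (trans (ℤ.⊖-≥ (ℕ.m≤m+n m n)) (cong +_ (ℕ.m+n∸m≡n m n)))

HasCount-Admissible : ∀ m {h R P} → length P ≡ m → WellFormed h R P →
  Σ ℕ λ N → HasCount (Admissible h R P) N × + N ≡ ∇fact m (suc (length R))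
HasCount-Admissible zero    {h} {R} {[]} _ wf = length R ! , HasCount-Admissible-[] h (WellFormed.!R wf) , refl
HasCount-Admissible (suc m) {h} {R} {(a , b) ∷ P} |P|≡1+m wf
  with N₀ , count₀ , N₀≡ ← HasCount-Admissible m (ℕ.suc-injective |P|≡1+m) (WellFormed-tail wf)
     | N₁ , count₁ , N₁≡ ← HasCount-Admissible m (trans (length-map _ P) (ℕ.suc-injective |P|≡1+m)) (WellFormed-contract wf)
  with Nab , N¬ab , countab , count¬ab , Nab+N¬ab≡N₀ ← HasCount-partition (λ w → consecutive? w a b) count₀
  = N¬ab
  , HasCount-cong (λ { _ ((headed , avoids) , ¬ab) → headed , ¬ab ∷ avoids })
                  (λ { _ (headed , ¬ab ∷ avoids) → (headed , avoids) , ¬ab }) count¬ab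
  , (begin
    + N¬ab                                     ≡⟨ +[m+n]-+m≡+n Nab N¬ab ⟨
    + (Nab + N¬ab) - + Nab                     ≡⟨ cong₂ (λ x y → + x - + y) Nab+N¬ab≡N₀ Nab≡N₁ ⟩
    + N₀ - + N₁                                ≡⟨ cong₂ _-_ N₀≡ N₁≡ ⟩
    ∇fact m (suc (length R)) - ∇fact m (suc (length (delete b R)))
                                               ≡⟨ cong (λ n → ∇fact m (suc (length R)) - ∇fact m n) |R|≡1+|R′| ⟨
    ∇fact (suc m) (suc (length R))             ∎)
  where
  open ≡-Reasoning
  Nab≡N₁ : Nab ≡ N₁
  Nab≡N₁ = HasCount-unique countab (HasCount-Consecutive wf count₁)
  |R|≡1+|R′| : length R ≡ suc (length (delete b R))
  |R|≡1+|R′| = ↭-length (↭-delete (WellFormed.!R wf) (b∈R wf))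

forbiddenPairs : ℕ → ℕ → Pairs
forbiddenPairs n k = applyUpTo (λ i → suc i , suc i + k) (n ∸ k)

WellFormed-forbiddenPairs : ∀ n k → WellFormed 1 (applyUpTo (suc ∘ suc) n) (forbiddenPairs (suc n) (suc k))
WellFormed-forbiddenPairs n k = record
  { h∉R      = 1∉R
  ; !R       = Unique.applyUpTo⁺₁ (suc ∘ suc) n (λ i<j _ → ℕ.<⇒≢ i<j ∘ ℕ.suc-injective ∘ ℕ.suc-injective)
  ; ordered  = All.applyUpTo⁺₁ _ (n ∸ k) pair-ordered
  ; !sources = subst Unique (sym (map-applyUpTo _ proj₁ (n ∸ k)))
      (Unique.applyUpTo⁺₁ suc (n ∸ k) (λ i<j _ → ℕ.<⇒≢ i<j ∘ ℕ.suc-injective))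
  ; !targets = subst Unique (sym (map-applyUpTo _ proj₂ (n ∸ k)))
      (Unique.applyUpTo⁺₁ (λ i → suc i + suc k) (n ∸ k)
        (λ i<j _ → ℕ.<⇒≢ i<j ∘ ℕ.+-cancelʳ-≡ (suc k) _ _ ∘ ℕ.suc-injective))
  }
  where
  R : List ℕ
  R = applyUpTo (suc ∘ suc) n

  1∉R : 1 ∉ R
  1∉R 1∈R with _ , _ , () ← ∈-applyUpTo⁻ (suc ∘ suc) 1∈R
  pair-ordered : ∀ {i} → i < n ∸ k → suc i < suc i + suc k × suc i ∈ 1 ∷ R × suc i + suc k ∈ R
  pair-ordered {i} i<n∸k = ℕ.m<m+n (suc i) (s≤s z≤n) , source∈ i (ℕ.<-≤-trans i<n∸k (ℕ.m∸n≤m n k)) , target∈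
    where
    source∈ : ∀ i → i < n → suc i ∈ 1 ∷ R
    source∈ zero     _   = here refl
    source∈ (suc i′) i<n = there (∈-applyUpTo⁺ (suc ∘ suc) (ℕ.<-trans (ℕ.n<1+n i′) i<n))
    k<n : k < n
    k<n = ℕ.m∸n≢0⇒n<m (λ n∸k≡0 → ℕ.n≮0 (subst (i <_) n∸k≡0 i<n∸k))
    i+k<n : i + k < n
    i+k<n = ℕ.m≤o∸n⇒m+n≤o (suc i) (ℕ.<⇒≤ k<n) i<n∸k
    target∈ : suc i + suc k ∈ R
    target∈ = subst (_∈ R) (cong suc (sym (ℕ.+-suc i k))) (∈-applyUpTo⁺ (suc ∘ suc) i+k<n)

module _ (n k : ℕ) where

  private
    R : List ℕ
    R = applyUpTo (suc ∘ suc) n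

    P : Pairs
    P = forbiddenPairs (suc n) (suc k)

  -- No forbidden pair ends in 1, so the wrap-around from the last letter back to 1 is irrelevant.
  Admissible⇒CircPerm×AvoidsAll : ∀ w → Admissible 1 R P w → CircPerm (suc n) w × AvoidsAll (suc n) (suc k) w
  Admissible⇒CircPerm×AvoidsAll w ((r , refl , r↭R) , avoids) = (r , refl , prep 1 r↭R) , avoidsAll
    where
    avoidsAll : AvoidsAll (suc n) (suc k) w
    avoidsAll (suc i) _ i<n∸k follows = All.applyUpTo⁻ _ (n ∸ k) avoids i<n∸k
      (Consecutive-∷ʳ⁻ (1 ∷ r) (ℕ.m+1+n≢0 i ∘ ℕ.suc-injective) (Adjacent⇒Consecutive follows))

  CircPerm×AvoidsAll⇒Admissible : ∀ w → CircPerm (suc n) w × AvoidsAll (suc n) (suc k) w → Admissible 1 R P w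
  CircPerm×AvoidsAll⇒Admissible w ((r , refl , w↭) , avoidsAll) =
    (r , refl , drop-∷ w↭) ,
    All.applyUpTo⁺₁ _ (n ∸ k) λ {i} i<n∸k consecutive →
      avoidsAll (suc i) (s≤s z≤n) i<n∸k (Consecutive⇒Adjacent (w ++ [ 1 ]) (Consecutive-∷ʳ⁺ w consecutive))

corollary2p3 : (n k : ℕ) → 2 ≤ n → 1 ≤ k → k ≤ n ∸ 1 →
    Σ ℕ (λ c → HasCount (λ w → CircPerm n w × AvoidsAll n k w) c × (+ c ≡ formula n k))
corollary2p3 (suc n) (suc k) _ _ _
  with N , count , N≡∇fact ← HasCount-Admissible (n ∸ k) (length-applyUpTo _ (n ∸ k)) (WellFormed-forbiddenPairs n k) =
  N ,
  HasCount-cong (Admissible⇒CircPerm×AvoidsAll n k) (CircPerm×AvoidsAll⇒Admissible n k) count ,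
  (begin
    + N                                               ≡⟨ N≡∇fact ⟩
    ∇fact (n ∸ k) (suc (length (applyUpTo _ n)))      ≡⟨ cong (∇fact (n ∸ k) ∘ suc) (length-applyUpTo _ n) ⟩
    ∇fact (n ∸ k) (suc n)                             ≡⟨ formula≡∇fact (suc n) (suc k) ⟨
    formula (suc n) (suc k)                           ∎)
  where open ≡-Reasoning
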